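{- Let $b,m\in\mathbb{N}$ with $b\ge 2$. Let $\mathcal{P}_0,\dots,\mathcal{P}_{b-1}$ be (not necessarily different) $(0,m-1,2)$-nets in base $b$, each contained in $\mathbb{Q}(b^{m-1})\times\mathbb{Q}(b^{m-1})$, and let $\pi_0,\dots,\pi_{b^{m-1}-1}\in\mathcal{S}_b$ be permutations. Put $$\widehat{\mathcal{P}}=\bigcup_{j=0}^{b-1}A_b(\mathcal{P}_j+(j,0))\quad\text{and}\quad \mathcal{P}=\psi_{b,m}(\widehat{\mathcal{P}}).$$ Then $\mathcal{P}$ is a $(0,m,2)$-net in base $b$.
   Context: An elementary $b$-adic interval in $[0,1)^2$ is a set $\prod_{j=1}^2\left[\frac{a_j}{b^{d_j}},\frac{a_j+1}{b^{d_j}}\right)$ with $d_j\in\mathbb{N}_0$, $a_j\in\{0,\dots,b^{d_j}-1\}$. A $b^k$-element point set (multiset) in $[0,1)^2$ is a $(0,k,2)$-net in base $b$ if every elementary $b$-adic interval of area $b^{ -k}$ contains exactly one of its points. Let $\mathbb{Q}(b^k)=\{0,\frac1{b^k},\dots,\frac{b^k-1}{b^k}\}$ and let $\mathcal{S}_b$ be the set of permutations of $\{0,\dots,b-1\}$. $A_b:\mathbb{R}^2\to\mathbb{R}^2$ is $A_b(x,y)=(x/b,y)$; $\mathcal{P}_j+(j,0)$ is the translate of $\mathcal{P}_j$ by $(j,0)$; unions are taken as multisets. Given the permutations $\pi_0,\dots,\pi_{b^{m-1}-1}$, the map $\psi_{b,m}:\mathbb{Q}(b^m)\times\mathbb{Q}(b^{m-1})\to\mathbb{Q}(b^m)\times\mathbb{Q}(b^m)$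 is $\psi_{b,m}(x,y)=(x,\,y+\pi_{b^{m-1}y}(\lfloor bx\rfloor)\,b^{ -m})$, applied pointwise to $\widehat{\mathcal{P}}$. -}

module Defs where

open import Data.Nat using (ℕ; zero; suc; _+_; _*_; _∸_; _^_; _≤_; _<_; _≤?_; _<?_; s≤s; z≤n; NonZero; >-nonZero)
open import Data.Nat.DivMod using (_/_)
open import Data.Nat.Properties using (m^n≢0; ≤-trans)
open import Data.Bool using (Bool; true; false; _∧_; if_then_else_)
open import Data.Fin using (Fin; toℕ; fromℕ<)
open import Data.Fin.Permutation using (Permutation′; _⟨$⟩ʳ_)
open import Data.List using (List; []; _∷_; length; map; concatMap)
open import Data.List.Relation.Unary.All using (All)
open import Data.Product using (_×_; _,_)
open import Relation.Nullary.Decidable using (⌊_⌋; yes; no)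
open import Relation.Binary.PropositionalEquality using (_≡_)

-- A point of [0,1)^2 with coordinates in Q(b^dx) × Q(b^dy) is represented by
-- its pair of numerators (X , Y), meaning (X / b^dx , Y / b^dy).
Point : Set
Point = ℕ × ℕ

-- multiset = list; count of elements satisfying a boolean predicate
countB : {A : Set} → (A → Bool) → List A → ℕ
countB p [] = 0
countB p (x ∷ xs) = if p x then suc (countB p xs) else countB p xs

-- X / b^den ∈ [ a / b^d , (a+1) / b^d )
inInterval : (b den d a X : ℕ) → Bool
inInterval b den d a X = ⌊ a * b ^ den ≤? X * b ^ d ⌋ ∧ ⌊ X * b ^ d <? suc a * b ^ den ⌋

inElem : (b dx dy d1 a1 d2 a2 : ℕ) → Point → Bool
inElem b dx dy d1 a1 d2 a2 (X , Y) = inInterval b dx d1 a1 X ∧ inInterval b dy d2 a2 Y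

InUnitSquare : (b dx dy : ℕ) → Point → Set
InUnitSquare b dx dy (X , Y) = (X < b ^ dx) × (Y < b ^ dy)

record IsNet (b k dx dy : ℕ) (P : List Point) : Set where
  field
    inSquare : All (InUnitSquare b dx dy) P
    size     : length P ≡ b ^ k
    exactlyOne : (d1 d2 : ℕ) → d1 + d2 ≡ k →
                 (a1 a2 : ℕ) → a1 < b ^ d1 → a2 < b ^ d2 →
                 countB (inElem b dx dy d1 a1 d2 a2) P ≡ 1

-- A_b(P_j + (j,0)) for P_j ⊆ Q(b^(m-1))^2 : the point (X/b^(m-1), Y/b^(m-1))
-- goes to ((X + j b^(m-1)) / b^m , Y / b^(m-1)).
shiftScale : (b m j : ℕ) → Point → Point
shiftScale b m j (X , Y) = (X + j * b ^ (m ∸ 1) , Y)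

-- P̂ = ⋃_{j<b} A_b(P_j + (j,0))  (multiset union), points in Q(b^m) × Q(b^(m-1))
Phat : (b m : ℕ) → (Fin b → List Point) → List Point
Phat b m P = concatMap (λ j → map (shiftScale b m (toℕ j)) (P j)) (Data.List.allFin b)
  where import Data.List

-- π_i(c) as a natural number, for i < b^(m-1), c < b (0 otherwise; never used)
applyπ : (b m : ℕ) → (Fin (b ^ (m ∸ 1)) → Permutation′ b) → ℕ → ℕ → ℕ
applyπ b m π i c with i <? b ^ (m ∸ 1) | c <? b
... | yes p | yes q = toℕ (π (fromℕ< p) ⟨$⟩ʳ fromℕ< q)
... | _     | _     = 0

-- ψ_{b,m}(x,y) = (x , y + π_{b^(m-1) y}(⌊b x⌋) b^{-m}) on numerators:
-- x = X/b^m, y = Y/b^(m-1); b^(m-1) y = Y, ⌊b x⌋ = ⌊X / b^(m-1)⌋,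
-- new y = (b Y + π_Y(⌊b x⌋)) / b^m.
ψ : (b m : ℕ) → 2 ≤ b → (Fin (b ^ (m ∸ 1)) → Permutation′ b) → Point → Point
ψ b m b≥2 π (X , Y) =
  (X , b * Y + applyπ b m π Y (_/_ X (b ^ (m ∸ 1)) {{m^n≢0 b (m ∸ 1) {{>-nonZero (≤-trans (s≤s z≤n) b≥2)}}}}))

module Submission where

-- Write n = m-1.  A point (X,Y) of P_j is sent to
--   (X + j b^n , b Y + π_Y(j))        (numerators over b^m),
-- so the image of P_j is the j-th vertical strip of width 1/b.  Fix an
-- elementary interval with d1 + d2 = m.
--   * If d1 = e+1 ≥ 1, the interval lies inside strip J = ⌊a1/b^e⌋, and a
--     point of strip j lands in it iff j = J and the original point lies in
--     the elementary interval (e, a1 mod b^e) × (d2, a2) of P_J (the new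
--     y-digits are the old ones, since π_Y(j) < b is only a last digit).
--   * If d1 = 0 (so d2 = m), the interval is a horizontal line of height
--     1/b^m; a point lands in it iff Y = ⌊a2/b⌋ and π_Y(j) = a2 mod b, i.e.
--     iff j is the unique J with π_{⌊a2/b⌋}(J) = a2 mod b and (X,Y) lies in
--     the row (0,0) × (n,⌊a2/b⌋) of P_J.

open import Defs
open import Data.Nat using (ℕ; zero; suc; _+_; _*_; _∸_; _^_; _≤_; _<_; _≤?_; _<?_; _≡ᵇ_; s≤s; s≤s⁻¹; z≤n; NonZero; >-nonZero; >-nonZero⁻¹)
open import Data.Nat.Properties hiding (_≟_)
open import Data.Nat.DivMod
open import Data.Fin using (Fin; toℕ; fromℕ<; _≟_)
import Data.Fin as Fin
import Data.Fin.Properties as Fin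
open import Data.Fin.Permutation using (Permutation′; _⟨$⟩ʳ_; _⟨$⟩ˡ_; inverseˡ; inverseʳ)
open import Data.List using (List; []; _∷_; map; length; _++_; concat; concatMap; tabulate; allFin)
open import Data.List.Properties using (length-++; length-map; map-tabulate)
open import Data.List.Relation.Unary.All using (All; []; _∷_)
import Data.List.Relation.Unary.All as All
import Data.List.Relation.Unary.All.Properties as All
open import Data.Bool using (Bool; true; false; _∧_; if_then_else_; T)
open import Data.Bool.Properties using (∧-assoc)
open import Data.Unit using (tt)
open import Data.Empty using (⊥-elim)
open import Data.Product using (_×_; _,_)
open import Function using (_∘_; id)
open import Relation.Nullary using (does)
open import Relation.Nullary.Decidable using (⌊_⌋; yes; no; toWitness; fromWitness; dec-true; dec-false)
open import Relation.Binary.PropositionalEquality hiding (J)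

private
  variable
    A B : Set
    k : ℕ

T-ext : {x y : Bool} → (T x → T y) → (T y → T x) → x ≡ y
T-ext {false} {false} _ _     = refl
T-ext {false} {true}  _ y⇒x   = ⊥-elim (y⇒x tt)
T-ext {true}  {false} x⇒y _   = ⊥-elim (x⇒y tt)
T-ext {true}  {true}  _ _     = refl

∧-split : ∀ x {y} → T (x ∧ y) → T x × T y
∧-split true t = tt , t

∧-pair : ∀ x {y} → T x → T y → T (x ∧ y)
∧-pair true _ t = t

toℕ-≡ᵇ : (i j : Fin k) → (toℕ i ≡ᵇ toℕ j) ≡ does (i ≟ j)
toℕ-≡ᵇ Fin.zero    Fin.zero    = refl
toℕ-≡ᵇ Fin.zero    (Fin.suc j) = refl
toℕ-≡ᵇ (Fin.suc i) Fin.zero    = refl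
toℕ-≡ᵇ (Fin.suc i) (Fin.suc j) = toℕ-≡ᵇ i j

countB-map : (p : B → Bool) (f : A → B) (xs : List A) →
             countB p (map f xs) ≡ countB (λ x → p (f x)) xs
countB-map p f [] = refl
countB-map p f (x ∷ xs) with p (f x)
... | true  = cong suc (countB-map p f xs)
... | false = countB-map p f xs

countB-++ : (p : A → Bool) (xs ys : List A) → countB p (xs ++ ys) ≡ countB p xs + countB p ys
countB-++ p [] ys = refl
countB-++ p (x ∷ xs) ys with p x
... | true  = cong suc (countB-++ p xs ys)
... | false = countB-++ p xs ys

countB-ext : {Q : A → Set} {p q : A → Bool} {xs : List A} →
             All Q xs → (∀ {x} → Q x → p x ≡ q x) → countB p xs ≡ countB q xs
countB-ext [] _ = refl
countB-ext {q = q} {xs = x ∷ _} (qx ∷ qxs) p≡q rewrite p≡q qx =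
  cong (λ c → if q x then suc c else c) (countB-ext qxs p≡q)

countB-false : (xs : List A) → countB (λ _ → false) xs ≡ 0
countB-false []       = refl
countB-false (_ ∷ xs) = countB-false xs

countB-concat-none : (p : A → Bool) (g : Fin k → List A) →
                     (∀ j → countB p (g j) ≡ 0) → countB p (concat (tabulate g)) ≡ 0
countB-concat-none {k = zero}  p g none = refl
countB-concat-none {k = suc k} p g none =
  trans (countB-++ p (g Fin.zero) _)
        (cong₂ _+_ (none Fin.zero) (countB-concat-none p (g ∘ Fin.suc) (none ∘ Fin.suc)))

countB-concat-single : (p : A → Bool) (g : Fin k → List A) (J : Fin k) →
                       (∀ j → j ≢ J → countB p (g j) ≡ 0) →
                       countB p (concat (tabulate g)) ≡ countB p (g J)
countB-concat-single p g Fin.zero others =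
  trans (countB-++ p (g Fin.zero) _)
   (trans (cong (countB p (g Fin.zero) +_)
                (countB-concat-none p (g ∘ Fin.suc) (λ j → others (Fin.suc j) λ ())))
          (+-identityʳ _))
countB-concat-single p g (Fin.suc J) others =
  trans (countB-++ p (g Fin.zero) (concat (tabulate (g ∘ Fin.suc))))
   (trans (cong (_+ countB p (concat (tabulate (g ∘ Fin.suc)))) (others Fin.zero λ ()))
          (countB-concat-single p (g ∘ Fin.suc) J
             (λ j j≢J → others (Fin.suc j) (j≢J ∘ Fin.suc-injective))))

length-concat-const : (g : Fin k → List A) (L : ℕ) →
                      (∀ j → length (g j) ≡ L) → length (concat (tabulate g)) ≡ k * L
length-concat-const {k = zero}  g L len = refl
length-concat-const {k = suc k} g L len =
  trans (length-++ (g Fin.zero))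
        (cong₂ _+_ (len Fin.zero) (length-concat-const (g ∘ Fin.suc) L (len ∘ Fin.suc)))

concatMap-allFin : (g : Fin k → List A) → concatMap g (allFin k) ≡ concat (tabulate g)
concatMap-allFin g = cong concat (map-tabulate id g)

countB-select-block : {Q : A → Set} (P : Fin k → List A) → (∀ j → All Q (P j)) →
  (f : Fin k → A → B) (p : B → Bool) (q : A → Bool) (J : Fin k) →
  (∀ j {x} → Q x → p (f j x) ≡ does (j ≟ J) ∧ q x) →
  countB p (concatMap (λ j → map (f j) (P j)) (allFin k)) ≡ countB q (P J)
countB-select-block P allQ f p q J member =
  trans (cong (countB p) (concatMap-allFin block))
   (trans (countB-concat-single p block J outside) inside)
  where
  block = λ j → map (f j) (P j)
  outside : ∀ j → j ≢ J → countB p (block j) ≡ 0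
  outside j j≢J =
    trans (countB-map p (f j) (P j))
     (trans (countB-ext (allQ j) (λ Qx → trans (member j Qx) (cong (_∧ _) (dec-false (j ≟ J) j≢J))))
            (countB-false (P j)))
  inside : countB p (block J) ≡ countB q (P J)
  inside =
    trans (countB-map p (f J) (P J))
          (countB-ext (allQ J) (λ Qx → trans (member J Qx) (cong (_∧ _) (dec-true (J ≟ J) refl))))

quotient-unique : ∀ {n} .{{_ : NonZero n}} q r → r < n → (r + q * n) / n ≡ q
quotient-unique {n} q r r<n = begin
  (r + q * n) / n     ≡⟨ +-distrib-/ r (q * n) remainders<n ⟩
  r / n + q * n / n   ≡⟨ cong₂ _+_ (m<n⇒m/n≡0 r<n) (m*n/n≡m q n) ⟩
  q                   ∎
  where
  open ≡-Reasoning
  remainders<n : r % n + q * n % n < n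
  remainders<n = subst (_< n) (sym (trans (cong₂ _+_ (m<n⇒m%n≡m r<n) (m*n%n≡0 q n)) (+-identityʳ r))) r<n

remainder-unique : ∀ {n} .{{_ : NonZero n}} q r → r < n → (r + q * n) % n ≡ r
remainder-unique {n} q r r<n = trans ([m+kn]%n≡m%n r q n) (m<n⇒m%n≡m r<n)

digits-ᵇ : ∀ {E} .{{_ : NonZero E}} q j a → q < E →
           (q + j * E ≡ᵇ a) ≡ (j ≡ᵇ a / E) ∧ (q ≡ᵇ a % E)
digits-ᵇ {E} q j a q<E = T-ext to from
  where
  to : T (q + j * E ≡ᵇ a) → T ((j ≡ᵇ a / E) ∧ (q ≡ᵇ a % E))
  to t with ≡ᵇ⇒≡ (q + j * E) a t
  ... | refl = ∧-pair (j ≡ᵇ _) (≡⇒≡ᵇ _ _ (sym (quotient-unique j q q<E)))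
                                (≡⇒≡ᵇ _ _ (sym (remainder-unique j q q<E)))
  from : T ((j ≡ᵇ a / E) ∧ (q ≡ᵇ a % E)) → T (q + j * E ≡ᵇ a)
  from t with ∧-split (j ≡ᵇ a / E) t
  ... | tj , tq with ≡ᵇ⇒≡ j (a / E) tj | ≡ᵇ⇒≡ q (a % E) tq
  ...   | refl | refl = ≡⇒≡ᵇ _ _ (sym (m≡m%n+[m/n]*n a E))

floor-unique : ∀ {K} .{{_ : NonZero K}} a X → a * K ≤ X → X < suc a * K → X / K ≡ a
floor-unique {K} a X lo hi =
  ≤-antisym (s≤s⁻¹ (m<n*o⇒m/o<n hi)) (subst (_≤ X / K) (m*n/n≡m a K) (/-monoˡ-≤ K lo))

floor-upper : ∀ {K} .{{_ : NonZero K}} X → X < suc (X / K) * K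
floor-upper {K} X = begin-strict
  X                 ≡⟨ m≡m%n+[m/n]*n X K ⟩
  X % K + X / K * K <⟨ +-monoˡ-< (X / K * K) (m%n<n X K) ⟩
  suc (X / K) * K   ∎
  where open ≤-Reasoning

floor-shift : ∀ {K E} .{{_ : NonZero K}} X j → (X + j * (E * K)) / K ≡ X / K + j * E
floor-shift {K} {E} X j =
  trans (/-congˡ decompose) (quotient-unique (X / K + j * E) (X % K) (m%n<n X K))
  where
  open ≡-Reasoning
  decompose : X + j * (E * K) ≡ X % K + (X / K + j * E) * K
  decompose = begin
    X + j * (E * K)                 ≡⟨ cong (_+ j * (E * K)) (m≡m%n+[m/n]*n X K) ⟩
    X % K + X / K * K + j * (E * K) ≡⟨ +-assoc (X % K) _ _ ⟩
    X % K + (X / K * K + j * (E * K)) ≡⟨ cong (λ t → X % K + (X / K * K + t)) (sym (*-assoc j E K)) ⟩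
    X % K + (X / K * K + j * E * K) ≡⟨ cong (X % K +_) (sym (*-distribʳ-+ K (X / K) (j * E))) ⟩
    X % K + (X / K + j * E) * K   ∎

module Digits (b : ℕ) .{{_ : NonZero b}} where

  _/b^_ _%b^_ : ℕ → ℕ → ℕ
  X /b^ e = _/_ X (b ^ e) {{m^n≢0 b e}}
  X %b^ e = _%_ X (b ^ e) {{m^n≢0 b e}}

  ^-split : ∀ {d den} → d ≤ den → b ^ den ≡ b ^ (den ∸ d) * b ^ d
  ^-split {d} {den} d≤den =
    trans (cong (b ^_) (sym (m∸n+n≡m d≤den))) (^-distribˡ-+-* b (den ∸ d) d)

  inInterval-digits : ∀ {den d} a X → d ≤ den →
                      inInterval b den d a X ≡ (X /b^ (den ∸ d) ≡ᵇ a)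
  inInterval-digits {den} {d} a X d≤den = T-ext to from
    where
    K = b ^ (den ∸ d)
    D = b ^ d
    instance
      K≢0 : NonZero K
      K≢0 = m^n≢0 b (den ∸ d)
      D≢0 : NonZero D
      D≢0 = m^n≢0 b d
    rescale : ∀ c → c * b ^ den ≡ c * K * D
    rescale c = trans (cong (c *_) (^-split d≤den)) (sym (*-assoc c K D))
    lower = a * b ^ den ≤? X * D
    upper = X * D <? suc a * b ^ den
    to : T (⌊ lower ⌋ ∧ ⌊ upper ⌋) → T (X / K ≡ᵇ a)
    to t = let lo , hi = ∧-split ⌊ lower ⌋ t in ≡⇒≡ᵇ (X / K) a (floor-unique a X
          (*-cancelʳ-≤ (a * K) X D (subst (_≤ X * D) (rescale a) (toWitness lo)))
          (*-cancelʳ-< D X (suc a * K) (subst (X * D <_) (rescale (suc a)) (toWitness hi))))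
    from : T (X / K ≡ᵇ a) → T (⌊ lower ⌋ ∧ ⌊ upper ⌋)
    from t = ∧-pair ⌊ lower ⌋
        (fromWitness (subst (_≤ X * D) (sym (rescale a)) (*-monoˡ-≤ D aK≤X)))
        (fromWitness (subst (X * D <_) (sym (rescale (suc a))) (*-monoˡ-< D X<[1+a]K)))
      where
      X/K≡a = ≡ᵇ⇒≡ (X / K) a t
      aK≤X : a * K ≤ X
      aK≤X = subst (λ c → c * K ≤ X) X/K≡a (m/n*n≤m X K)
      X<[1+a]K : X < suc a * K
      X<[1+a]K = subst (λ c → X < suc c * K) X/K≡a (floor-upper {K} X)

  inInterval-whole : ∀ den X → X < b ^ den → inInterval b den 0 0 X ≡ true
  inInterval-whole den X X< =
    trans (inInterval-digits {den} {0} 0 X z≤n) (cong (_≡ᵇ 0) (m<n⇒m/n≡0 {{m^n≢0 b den}} X<))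

  inInterval-point : ∀ den a X → inInterval b den den a X ≡ (X ≡ᵇ a)
  inInterval-point den a X =
    trans (inInterval-digits {den} {den} a X ≤-refl)
          (cong (_≡ᵇ a) (trans (/-congʳ {{m^n≢0 b (den ∸ den)}} (cong (b ^_) (n∸n≡0 den))) (n/1≡n X)))

  -- Shifting X < b^n by j blocks of size b^n prepends the digit j: the
  -- leading e+1 digits are a iff j = ⌊a/b^e⌋ and the leading e digits of X
  -- are a mod b^e.
  shifted-digits : ∀ {e n} X j a → e ≤ n → X < b ^ n →
    ((X + j * b ^ n) /b^ (n ∸ e) ≡ᵇ a) ≡ (j ≡ᵇ a /b^ e) ∧ (X /b^ (n ∸ e) ≡ᵇ a %b^ e)
  shifted-digits {e} {n} X j a e≤n X< = begin
    ((X + j * b ^ n) / K ≡ᵇ a)    ≡⟨ cong (λ N → (X + j * N) / K ≡ᵇ a) b^n≡EK ⟩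
    ((X + j * (E * K)) / K ≡ᵇ a)  ≡⟨ cong (_≡ᵇ a) (floor-shift {K} {E} X j) ⟩
    (X / K + j * E ≡ᵇ a)          ≡⟨ digits-ᵇ {E} (X / K) j a (m<n*o⇒m/o<n (subst (X <_) b^n≡EK X<)) ⟩
    (j ≡ᵇ a / E) ∧ (X / K ≡ᵇ a % E) ∎
    where
    open ≡-Reasoning
    K = b ^ (n ∸ e)
    E = b ^ e
    instance
      K≢0 : NonZero K
      K≢0 = m^n≢0 b (n ∸ e)
      E≢0 : NonZero E
      E≢0 = m^n≢0 b e
    b^n≡EK : b ^ n ≡ E * K
    b^n≡EK = trans (^-split e≤n) (*-comm K E)

  appended-digits : ∀ {d n} Y c → d ≤ n → c < b →
                    (b * Y + c) /b^ (suc n ∸ d) ≡ Y /b^ (n ∸ d)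
  appended-digits {d} {n} Y c d≤n c<b = begin
    (b * Y + c) / b ^ (suc n ∸ d) ≡⟨ /-congʳ (cong (b ^_) (+-∸-assoc 1 d≤n)) ⟩
    (b * Y + c) / (b * L)         ≡⟨ sym (m/n/o≡m/[n*o] (b * Y + c) b L) ⟩
    (b * Y + c) / b / L           ≡⟨ cong (_/ L) (trans (/-congˡ last-digit) (quotient-unique Y c c<b)) ⟩
    Y / L                         ∎
    where
    open ≡-Reasoning
    L = b ^ (n ∸ d)
    instance
      L≢0 : NonZero L
      L≢0 = m^n≢0 b (n ∸ d)
      bL≢0 : NonZero (b * L)
      bL≢0 = m^n≢0 b (suc (n ∸ d))
      b^[1+n-d]≢0 : NonZero (b ^ (suc n ∸ d))
      b^[1+n-d]≢0 = m^n≢0 b (suc n ∸ d)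
    last-digit : b * Y + c ≡ c + Y * b
    last-digit = trans (+-comm (b * Y) c) (cong (c +_) (*-comm b Y))

-- The construction for m = n + 1, with the permutation table π fixed.
module Construction (b n : ℕ) (b≥2 : 2 ≤ b) (π : Fin (b ^ n) → Permutation′ b) where

  instance
    b≢0 : NonZero b
    b≢0 = >-nonZero (≤-trans (s≤s z≤n) b≥2)
    b^n≢0 : NonZero (b ^ n)
    b^n≢0 = m^n≢0 b n

  open Digits b

  place : Fin b → Point → Point
  place j pt = ψ b (suc n) b≥2 π (shiftScale b (suc n) (toℕ j) pt)

  entry<b : ∀ Y i → applyπ b (suc n) π Y i < b
  entry<b Y i with Y <? b ^ n | i <? b
  ... | yes _ | yes _ = Fin.toℕ<n _
  ... | yes _ | no _  = >-nonZero⁻¹ b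
  ... | no _  | _     = >-nonZero⁻¹ b

  entry-row : ∀ {Y} (Y< : Y < b ^ n) (j : Fin b) →
              applyπ b (suc n) π Y (toℕ j) ≡ toℕ (π (fromℕ< Y<) ⟨$⟩ʳ j)
  entry-row {Y} Y< j with Y <? b ^ n | toℕ j <? b
  ... | yes _  | yes j< = cong (λ i → toℕ (π (fromℕ< Y<) ⟨$⟩ʳ i)) (Fin.fromℕ<-toℕ j j<)
  ... | yes _  | no j≮  = ⊥-elim (j≮ (Fin.toℕ<n j))
  ... | no Y≮  | _      = ⊥-elim (Y≮ Y<)

  -- Row A of the table is a permutation, so the digit R < b occurs in it in
  -- exactly one column, namely π_A⁻¹(R).
  column-of : ∀ {A R} → A < b ^ n → R < b → Fin b
  column-of A< R< = π (fromℕ< A<) ⟨$⟩ˡ fromℕ< R<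

  row-select : ∀ {A R} (A< : A < b ^ n) (R< : R < b) Y (j : Fin b) →
    (Y ≡ᵇ A) ∧ (applyπ b (suc n) π Y (toℕ j) ≡ᵇ R) ≡ (toℕ j ≡ᵇ toℕ (column-of A< R<)) ∧ (Y ≡ᵇ A)
  row-select {A} {R} A< R< Y j = T-ext to from
    where
    σ = π (fromℕ< A<)
    J = column-of A< R<
    entry-is-R = λ y i → applyπ b (suc n) π y (toℕ i) ≡ R
    only-J : ∀ i → entry-is-R A i → i ≡ J
    only-J i hit = trans (sym (inverseˡ σ)) (cong (σ ⟨$⟩ˡ_) (Fin.toℕ-injective
      (trans (sym (entry-row A< i)) (trans hit (sym (Fin.toℕ-fromℕ< R<))))))
    J-hits : entry-is-R A J
    J-hits = trans (entry-row A< J) (trans (cong toℕ (inverseʳ σ)) (Fin.toℕ-fromℕ< R<))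
    to : T ((Y ≡ᵇ A) ∧ (applyπ b (suc n) π Y (toℕ j) ≡ᵇ R)) → T ((toℕ j ≡ᵇ toℕ J) ∧ (Y ≡ᵇ A))
    to t = let Y≡ᵇA , hit = ∧-split (Y ≡ᵇ A) t in
      ∧-pair (toℕ j ≡ᵇ toℕ J)
        (≡⇒≡ᵇ _ _ (cong toℕ (only-J j (subst (λ y → entry-is-R y j) (≡ᵇ⇒≡ Y A Y≡ᵇA) (≡ᵇ⇒≡ _ R hit)))))
        Y≡ᵇA
    from : T ((toℕ j ≡ᵇ toℕ J) ∧ (Y ≡ᵇ A)) → T ((Y ≡ᵇ A) ∧ (applyπ b (suc n) π Y (toℕ j) ≡ᵇ R))
    from t = let j≡ᵇJ , Y≡ᵇA = ∧-split (toℕ j ≡ᵇ toℕ J) t in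
      ∧-pair (Y ≡ᵇ A) Y≡ᵇA
        (≡⇒≡ᵇ _ R (subst₂ entry-is-R (sym (≡ᵇ⇒≡ Y A Y≡ᵇA))
                                     (sym (Fin.toℕ-injective (≡ᵇ⇒≡ _ _ j≡ᵇJ))) J-hits))

  shifted< : ∀ X (j : Fin b) → X < b ^ n → X + toℕ j * b ^ n < b ^ suc n
  shifted< X j X< = ≤-trans (+-monoˡ-< (toℕ j * b ^ n) X<) (*-monoˡ-≤ (b ^ n) (Fin.toℕ<n j))

  appended< : ∀ Y c → Y < b ^ n → c < b → b * Y + c < b ^ suc n
  appended< Y c Y< c<b = ≤-trans (+-monoʳ-< (b * Y) c<b)
    (subst (_≤ b ^ suc n) (trans (*-suc b Y) (+-comm b (b * Y))) (*-monoʳ-≤ b Y<))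

  place-inSquare : ∀ j {pt} → InUnitSquare b n n pt → InUnitSquare b (suc n) (suc n) (place j pt)
  place-inSquare j {X , Y} (X< , Y<) = shifted< X j X< , appended< Y _ Y< (entry<b Y _)

  strip : ∀ e {a} → a < b ^ suc e → Fin b
  strip e a< = fromℕ< (m<n*o⇒m/o<n {{m^n≢0 b e}} a<)

  column-membership : ∀ {e d2} → e + d2 ≡ n → ∀ a1 a2 (a1< : a1 < b ^ suc e) j pt →
    InUnitSquare b n n pt →
    inElem b (suc n) (suc n) (suc e) a1 d2 a2 (place j pt)
      ≡ does (j ≟ strip e a1<) ∧ inElem b n n e (a1 %b^ e) d2 a2 pt
  column-membership {e} {d2} e+d2≡n a1 a2 a1< j (X , Y) (X< , Y<) = begin
    inInterval b (suc n) (suc e) a1 X′ ∧ inInterval b (suc n) d2 a2 Y′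
      ≡⟨ cong₂ _∧_ (inInterval-digits a1 X′ (s≤s e≤n)) (inInterval-digits a2 Y′ (m≤n⇒m≤1+n d2≤n)) ⟩
    (X′ /b^ (n ∸ e) ≡ᵇ a1) ∧ (Y′ /b^ (suc n ∸ d2) ≡ᵇ a2)
      ≡⟨ cong₂ _∧_ (shifted-digits X (toℕ j) a1 e≤n X<)
                   (cong (_≡ᵇ a2) (appended-digits Y _ d2≤n (entry<b Y _))) ⟩
    ((toℕ j ≡ᵇ a1 /b^ e) ∧ (X /b^ (n ∸ e) ≡ᵇ a1 %b^ e)) ∧ (Y /b^ (n ∸ d2) ≡ᵇ a2)
      ≡⟨ ∧-assoc (toℕ j ≡ᵇ a1 /b^ e) _ _ ⟩
    (toℕ j ≡ᵇ a1 /b^ e) ∧ ((X /b^ (n ∸ e) ≡ᵇ a1 %b^ e) ∧ (Y /b^ (n ∸ d2) ≡ᵇ a2))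
      ≡⟨ cong₂ _∧_ j-in-strip (sym (cong₂ _∧_ (inInterval-digits (a1 %b^ e) X e≤n)
                                              (inInterval-digits a2 Y d2≤n))) ⟩
    does (j ≟ strip e a1<) ∧ (inInterval b n e (a1 %b^ e) X ∧ inInterval b n d2 a2 Y) ∎
    where
    open ≡-Reasoning
    X′ = X + toℕ j * b ^ n
    Y′ = b * Y + applyπ b (suc n) π Y (X′ / b ^ n)
    e≤n : e ≤ n
    e≤n = subst (e ≤_) e+d2≡n (m≤m+n e d2)
    d2≤n : d2 ≤ n
    d2≤n = subst (d2 ≤_) e+d2≡n (m≤n+m d2 e)
    j-in-strip : (toℕ j ≡ᵇ a1 /b^ e) ≡ does (j ≟ strip e a1<)
    j-in-strip = trans (cong (toℕ j ≡ᵇ_) (sym (Fin.toℕ-fromℕ< _))) (toℕ-≡ᵇ j (strip e a1<))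

  row< : ∀ {a} → a < b ^ suc n → a / b < b ^ n
  row< {a} a< = m<n*o⇒m/o<n (subst (a <_) (*-comm b (b ^ n)) a<)

  row-column : ∀ {a} → a < b ^ suc n → Fin b
  row-column {a} a< = column-of (row< a<) (m%n<n a b)

  row-membership : ∀ a2 (a2< : a2 < b ^ suc n) j pt → InUnitSquare b n n pt →
    inElem b (suc n) (suc n) 0 0 (suc n) a2 (place j pt)
      ≡ does (j ≟ row-column a2<) ∧ inElem b n n 0 0 n (a2 / b) pt
  row-membership a2 a2< j (X , Y) (X< , Y<) = begin
    inInterval b (suc n) 0 0 X′ ∧ inInterval b (suc n) (suc n) a2 Y′
      ≡⟨ cong₂ _∧_ (inInterval-whole (suc n) X′ (shifted< X j X<)) (inInterval-point (suc n) a2 Y′) ⟩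
    (b * Y + applyπ b (suc n) π Y (X′ / b ^ n) ≡ᵇ a2)
      ≡⟨ cong (λ i → b * Y + applyπ b (suc n) π Y i ≡ᵇ a2) (quotient-unique (toℕ j) X X<) ⟩
    (b * Y + c ≡ᵇ a2)
      ≡⟨ cong (_≡ᵇ a2) (trans (+-comm (b * Y) c) (cong (c +_) (*-comm b Y))) ⟩
    (c + Y * b ≡ᵇ a2)
      ≡⟨ digits-ᵇ c Y a2 (entry<b Y _) ⟩
    (Y ≡ᵇ a2 / b) ∧ (c ≡ᵇ a2 % b)
      ≡⟨ row-select (row< a2<) (m%n<n a2 b) Y j ⟩
    (toℕ j ≡ᵇ toℕ (row-column a2<)) ∧ (Y ≡ᵇ a2 / b)
      ≡⟨ cong₂ _∧_ (toℕ-≡ᵇ j (row-column a2<))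
                   (sym (cong₂ _∧_ (inInterval-whole n X X<) (inInterval-point n (a2 / b) Y))) ⟩
    does (j ≟ row-column a2<) ∧ (inInterval b n 0 0 X ∧ inInterval b n n (a2 / b) Y) ∎
    where
    open ≡-Reasoning
    X′ = X + toℕ j * b ^ n
    Y′ = b * Y + applyπ b (suc n) π Y (X′ / b ^ n)
    c = applyπ b (suc n) π Y (toℕ j)

  module Union (P : Fin b → List Point) (nets : ∀ j → IsNet b n n n (P j)) where

    𝒫 : List Point
    𝒫 = map (ψ b (suc n) b≥2 π) (Phat b (suc n) P)

    count-in-one-net : (p q : Point → Bool) (J : Fin b) →
      (∀ j pt → InUnitSquare b n n pt → p (place j pt) ≡ does (j ≟ J) ∧ q pt) →
      countB p 𝒫 ≡ countB q (P J)
    count-in-one-net p q J member =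
      trans (countB-map p (ψ b (suc n) b≥2 π) (Phat b (suc n) P))
            (countB-select-block P (IsNet.inSquare ∘ nets) (shiftScale b (suc n) ∘ toℕ)
                                 (λ pt → p (ψ b (suc n) b≥2 π pt)) q J (λ j {pt} → member j pt))

    𝒫-inSquare : All (InUnitSquare b (suc n) (suc n)) 𝒫
    𝒫-inSquare = All.map⁺ (All.concat⁺ (All.map⁺ (All.tabulate⁺ λ j →
      All.map⁺ (All.map (place-inSquare j) (IsNet.inSquare (nets j))))))

    𝒫-size : length 𝒫 ≡ b ^ suc n
    𝒫-size = begin
      length 𝒫                                      ≡⟨ length-map _ (Phat b (suc n) P) ⟩
      length (Phat b (suc n) P)                     ≡⟨ cong length (concatMap-allFin block) ⟩
      length (concat (tabulate block))              ≡⟨ length-concat-const block (b ^ n) block-size ⟩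
      b * b ^ n                                     ∎
      where
      open ≡-Reasoning
      block = λ j → map (shiftScale b (suc n) (toℕ j)) (P j)
      block-size : ∀ j → length (block j) ≡ b ^ n
      block-size j = trans (length-map _ (P j)) (IsNet.size (nets j))

proposition2 : (b m : ℕ) → (b≥2 : 2 ≤ b) → 1 ≤ m →
    (P : Fin b → List Point) →
    ((j : Fin b) → IsNet b (m ∸ 1) (m ∸ 1) (m ∸ 1) (P j)) →
    (π : Fin (b ^ (m ∸ 1)) → Permutation′ b) →
    IsNet b m m m (map (ψ b m b≥2 π) (Phat b m P))
proposition2 b (suc n) b≥2 (s≤s z≤n) P nets π = record
  { inSquare   = 𝒫-inSquare
  ; size       = 𝒫-size
  ; exactlyOne = exactlyOne
  }
  where
  open Construction b n b≥2 π
  open Union P nets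
  open Digits b using (_%b^_)
  exactlyOne : ∀ d1 d2 → d1 + d2 ≡ suc n → ∀ a1 a2 → a1 < b ^ d1 → a2 < b ^ d2 →
               countB (inElem b (suc n) (suc n) d1 a1 d2 a2) 𝒫 ≡ 1
  -- a row of height b^-(n+1) meets one strip, in a row of height b^-n of its net
  exactlyOne zero .(suc n) refl .zero a2 (s≤s z≤n) a2< =
    trans (count-in-one-net _ _ (row-column a2<) (row-membership a2 a2<))
          (IsNet.exactlyOne (nets _) 0 n refl 0 (a2 / b) (s≤s z≤n) (row< a2<))
  -- an interval of width at most b^-1 lies in one strip
  exactlyOne (suc e) d2 e+d2≡n+1 a1 a2 a1< a2< =
    trans (count-in-one-net _ _ (strip e a1<) (column-membership {e} {d2} e+d2≡n a1 a2 a1<))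
          (IsNet.exactlyOne (nets _) e d2 e+d2≡n (a1 %b^ e) a2 (m%n<n a1 (b ^ e) {{m^n≢0 b e}}) a2<)
    where
    e+d2≡n = suc-injective e+d2≡n+1
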